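{- For every odd integer $n>0$, the string $uz(n)=1010\cdots1$ (of length $n$) is a truncated code.
   Context: For $n\ge1$, $uz(n)$ denotes the $n$-digit decimal number whose digits, read from left to right, are $1,0,1,0,\dots$ (starting with $1$ and alternating). Code: let $x=a_na_{n-1}\dots a_1a_0$ be a positive integer with $n+1\ge 2$ decimal digits and $a_n>a_0$. Its code is the string $z_0z_1\dots z_n$ of $0$s and $1$s defined by $z_{ -1}=0$, for $i=0,\dots,n-1$: $z_i=1$ if $a_i-a_{n-i}-z_{i-1}<0$ and $z_i=0$ otherwise; and $z_n=0$ (so $z_0=1$). A finite string of $0$s and $1$s is called a code if it is the code of some such $x$. If $z_0z_1\dots z_n$ is a code, the string $z_0\dots z_{n-1}$ (the code with its final $0$ removed) is called a truncated code. -}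

module Defs where

open import Data.Nat using (ℕ; zero; suc; _+_; _*_; _∸_; _^_; _≤_; _<_; _<ᵇ_)
open import Data.Nat.DivMod using (_/_; _%_)
open import Data.Bool using (if_then_else_)
open import Data.List using (List; map; upTo; _++_; [_])
open import Data.Product using (Σ; _×_; ∃-syntax)
open import Relation.Binary.PropositionalEquality using (_≡_)

-- Binary strings are lists of naturals, each 0 or 1.

digit : ℕ → ℕ → ℕ
digit x zero    = x % 10
digit x (suc i) = digit (x / 10) i

-- zPrev x n i = z_{i-1} for the number x = a_n ... a_0, with z_{-1} = 0, and
-- z_i = 1 iff a_i - a_{n-i} - z_{i-1} < 0, i.e. iff a_i < a_{n-i} + z_{i-1}.
zPrev : ℕ → ℕ → ℕ → ℕ
zPrev x n zero    = 0
zPrev x n (suc i) = if digit x i <ᵇ digit x (n ∸ i) + zPrev x n i then 1 else 0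

codeOf : ℕ → ℕ → List ℕ
codeOf x n = map (λ i → zPrev x n (suc i)) (upTo n) ++ [ 0 ]

IsCode : List ℕ → Set
IsCode c = ∃[ n ] ∃[ x ]
  (1 ≤ n × 10 ^ n ≤ x × x < 10 ^ suc n × digit x 0 < digit x n × c ≡ codeOf x n)

IsTruncatedCode : List ℕ → Set
IsTruncatedCode t = ∃[ c ] (IsCode c × ∃[ b ] (c ≡ t ++ [ b ]))

uz : ℕ → List ℕ
uz n = map (λ i → 1 ∸ (i % 2)) (upTo n)

-- Take x = 1010…10, the (n+1)-digit number whose digit a_i is i mod 2.  Since n is odd,
-- a_{n-i} = 1 - a_i, and by induction z_i = 1 - a_i: the comparison defining z_{i+1}
-- is a_{i+1} < a_{n-i-1} + z_i = (1 - a_{i+1}) + a_{i+1} = 1.  Hence the code of x is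
-- 1010…1 followed by 0.
module Submission where

open import Defs
open import Data.Nat using (ℕ; _<_; _%_)
open import Relation.Binary.PropositionalEquality using (_≡_)

open import Function using (_∘_)
open import Data.Nat using (zero; suc; _+_; _*_; _∸_; _^_; _≤_; _/_; _<ᵇ_; z≤n; s≤s)
open import Data.Nat.Properties
open import Data.Nat.DivMod
open import Data.List using ([_]; _++_)
open import Data.List.Properties using (map-cong-local)
open import Data.List.Relation.Unary.All as All using ()
open import Data.List.Membership.Propositional.Properties using (∈-upTo⁻)
open import Data.Product using (_,_)
open import Data.Bool using (if_then_else_)
open import Relation.Binary.PropositionalEquality
  using (refl; cong; cong₂; sym; trans; subst; subst₂; module ≡-Reasoning)

[d+m*10]%10≡d : ∀ {d} m → d < 10 → (d + m * 10) % 10 ≡ d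
[d+m*10]%10≡d {d} m d<10 = trans ([m+kn]%n≡m%n d m 10) (m<n⇒m%n≡m d<10)

[d+m*10]/10≡m : ∀ {d} m → d < 10 → (d + m * 10) / 10 ≡ m
[d+m*10]/10≡m {d} m d<10 = begin
  (d + m * 10) / 10     ≡⟨ +-distrib-/ d (m * 10) remainders<10 ⟩
  d / 10 + m * 10 / 10  ≡⟨ cong₂ _+_ (m<n⇒m/n≡0 d<10) (m*n/n≡m m 10) ⟩
  m                     ∎
  where
  open ≡-Reasoning
  remainders<10 : d % 10 + (m * 10) % 10 < 10
  remainders<10 = subst₂ (λ r s → r + s < 10) (sym (m<n⇒m%n≡m d<10)) (sym (m*n%n≡0 m 10))
                         (subst (_< 10) (sym (+-identityʳ d)) d<10)

fromDigits : (ℕ → ℕ) → ℕ → ℕ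
fromDigits f zero    = f 0
fromDigits f (suc n) = f 0 + fromDigits (f ∘ suc) n * 10

digit-fromDigits : ∀ {f} → (∀ i → f i < 10) →
                   ∀ n i → i ≤ n → digit (fromDigits f n) i ≡ f i
digit-fromDigits f<10 zero    zero    _         = m<n⇒m%n≡m (f<10 0)
digit-fromDigits {f} f<10 (suc n) zero _ = [d+m*10]%10≡d (fromDigits (f ∘ suc) n) (f<10 0)
digit-fromDigits {f} f<10 (suc n) (suc i) (s≤s i≤n) = trans
  (cong (λ m → digit m i) ([d+m*10]/10≡m (fromDigits (f ∘ suc) n) (f<10 0)))
  (digit-fromDigits (f<10 ∘ suc) n i i≤n)

fromDigits-< : ∀ {f} → (∀ i → f i < 10) → ∀ n → fromDigits f n < 10 ^ suc n
fromDigits-< f<10 zero        = f<10 0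
fromDigits-< {f} f<10 (suc n) = begin-strict
  f 0 + y * 10    <⟨ +-monoˡ-< (y * 10) (f<10 0) ⟩
  suc y * 10      ≤⟨ *-monoˡ-≤ 10 (fromDigits-< (f<10 ∘ suc) n) ⟩
  10 ^ suc n * 10 ≡⟨ *-comm (10 ^ suc n) 10 ⟩
  10 ^ suc (suc n) ∎
  where
  open ≤-Reasoning
  y : ℕ
  y = fromDigits (f ∘ suc) n

fromDigits-≥ : ∀ {f} n → 1 ≤ f n → 10 ^ n ≤ fromDigits f n
fromDigits-≥ zero        1≤fn = 1≤fn
fromDigits-≥ {f} (suc n) 1≤fn = begin
  10 * 10 ^ n    ≡⟨ *-comm 10 (10 ^ n) ⟩
  10 ^ n * 10    ≤⟨ *-monoˡ-≤ 10 (fromDigits-≥ n 1≤fn) ⟩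
  y * 10         ≤⟨ m≤n+m (y * 10) (f 0) ⟩
  f 0 + y * 10   ∎
  where
  open ≤-Reasoning
  y : ℕ
  y = fromDigits (f ∘ suc) n

suc-%2 : ∀ i → suc i % 2 ≡ 1 ∸ i % 2
suc-%2 zero          = refl
suc-%2 (suc zero)    = refl
suc-%2 (suc (suc i)) = suc-%2 i

odd-pred-%2 : ∀ n → suc n % 2 ≡ 1 → n % 2 ≡ 0
odd-pred-%2 zero          _   = refl
odd-pred-%2 (suc (suc n)) odd = odd-pred-%2 n odd

odd-∸-%2 : ∀ {n} i → n % 2 ≡ 1 → i ≤ n → (n ∸ i) % 2 ≡ 1 ∸ i % 2
odd-∸-%2               zero          odd _               = odd
odd-∸-%2 {suc n}       (suc zero)    odd _               = odd-pred-%2 n odd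
odd-∸-%2 {suc (suc n)} (suc (suc i)) odd (s≤s (s≤s i≤n)) = odd-∸-%2 i odd i≤n

zPrev-alternating : ∀ {x n} → (∀ i → i ≤ n → digit x i ≡ i % 2) → n % 2 ≡ 1 →
                    ∀ i → i < n → zPrev x n (suc i) ≡ 1 ∸ i % 2
zPrev-alternating {x} {n} digits odd zero _
  rewrite digits 0 z≤n | digits n ≤-refl | odd = refl
zPrev-alternating {x} {n} digits odd (suc i) i+1<n
  rewrite digits (suc i) (<⇒≤ i+1<n)
        | digits (n ∸ suc i) (m∸n≤m n (suc i))
        | odd-∸-%2 (suc i) odd (<⇒≤ i+1<n)
        | zPrev-alternating digits odd i (<-trans (n<1+n i) i+1<n)
        | sym (suc-%2 i)
  = borrow (suc i % 2) (m%n<n (suc i) 2)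
  where
  borrow : ∀ a → a < 2 → (if a <ᵇ (1 ∸ a) + a then 1 else 0) ≡ 1 ∸ a
  borrow zero          _ = refl
  borrow (suc zero)    _ = refl
  borrow (suc (suc _)) (s≤s (s≤s ()))

corollary3 : (n : ℕ) → 0 < n → n % 2 ≡ 1 → IsTruncatedCode (uz n)
corollary3 n 0<n odd =
  codeOf x n , (n , x , 0<n , lower , upper , units<leading , refl) , 0 ,
  cong (_++ [ 0 ]) (map-cong-local (All.tabulate λ i∈ →
    zPrev-alternating digits odd _ (∈-upTo⁻ i∈)))
  where
  %2<10 : ∀ i → i % 2 < 10
  %2<10 i = ≤-trans (m%n<n i 2) (s≤s (s≤s z≤n))
  x : ℕ
  x = fromDigits (_% 2) n
  digits : ∀ i → i ≤ n → digit x i ≡ i % 2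
  digits = digit-fromDigits %2<10 n
  lower : 10 ^ n ≤ x
  lower = fromDigits-≥ n (≤-reflexive (sym odd))
  upper : x < 10 ^ suc n
  upper = fromDigits-< %2<10 n
  units<leading : digit x 0 < digit x n
  units<leading rewrite digits 0 z≤n | digits n ≤-refl | odd = s≤s z≤n
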